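{- For every integer $n\ge 1$, with $a,b$ the two colors of $C_2$, $$\left|\Pi_n^{eq}\wr C_2(\{1^a1^b,1^a1^a\})\right|=\left|\Pi_n^{eq}\wr C_2(\{1^b1^a,1^a1^a\})\right|=\sum_{k=1}^n 2^k S(n,k).$$
   Context: $\Pi_n\wr C_2$ is the set of colored set partitions of $[n]$ with colors $a,b$ (a set partition of $[n]$ plus a color for each element). For colors $\gamma,\delta$, a colored partition eq-contains $1^\gamma1^\delta$ if some block contains elements $x<y$ with $x$ colored $\gamma$ and $y$ colored $\delta$. $\Pi_n^{eq}\wr C_2(R)$ is the set of colored partitions eq-containing no pattern in $R$. $S(n,k)$ is the Stirling number of the second kind. -}

module Defs where

open import Data.Bool using (Bool; true; false; _∧_; _∨_; not; T)
open import Data.Nat using (ℕ; zero; suc; _+_; _*_; _^_; _<ᵇ_)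
open import Data.Fin using (Fin; toℕ)
open import Data.Vec using (Vec; lookup)
open import Data.List using (List; allFin; map; upTo)
open import Data.Bool.ListAction using (all; any)
open import Data.Nat.ListAction using (sum)
open import Data.Product using (Σ; _×_)

data Color : Set where
  a b : Color

_==ᶜ_ : Color → Color → Bool
a ==ᶜ a = true
b ==ᶜ b = true
_ ==ᶜ _ = false

-- A set partition of [n] (elements 0..n-1 standing for 1..n) is encoded as an
-- equivalence relation on Fin n, given by its Boolean adjacency matrix:
-- (rel M i j) = true  iff  i and j lie in the same block.
Matrix : ℕ → Set
Matrix n = Vec (Vec Bool n) n

rel : ∀ {n} → Matrix n → Fin n → Fin n → Bool
rel M i j = lookup (lookup M i) j

_⇒ᵇ_ : Bool → Bool → Bool
x ⇒ᵇ y = not x ∨ y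

isEquivᵇ : ∀ {n} → Matrix n → Bool
isEquivᵇ {n} M =
  all (λ i → rel M i i) (allFin n) ∧
  all (λ i → all (λ j → rel M i j ⇒ᵇ rel M j i) (allFin n)) (allFin n) ∧
  all (λ i → all (λ j → all (λ k → (rel M i j ∧ rel M j k) ⇒ᵇ rel M i k)
                                 (allFin n)) (allFin n)) (allFin n)

-- A pattern 1^γ 1^δ is given by the pair (γ , δ).
Pattern : Set
Pattern = Color × Color

eqContainsᵇ : ∀ {n} → Matrix n → Vec Color n → Color → Color → Bool
eqContainsᵇ {n} M c γ δ =
  any (λ x → any (λ y → (toℕ x <ᵇ toℕ y) ∧ rel M x y ∧
                         (lookup c x ==ᶜ γ) ∧ (lookup c y ==ᶜ δ))
                 (allFin n)) (allFin n)

avoidsᵇ : ∀ {n} → List Pattern → Matrix n → Vec Color n → Bool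
avoidsᵇ R M c = all (λ p → not (eqContainsᵇ M c (Data.Product.proj₁ p) (Data.Product.proj₂ p))) R

ColPartAvoid : ℕ → List Pattern → Set
ColPartAvoid n R =
  Σ (Matrix n × Vec Color n)
    (λ Mc → T (isEquivᵇ (Data.Product.proj₁ Mc) ∧
               avoidsᵇ R (Data.Product.proj₁ Mc) (Data.Product.proj₂ Mc)))

S : ℕ → ℕ → ℕ
S zero    zero    = 1
S zero    (suc k) = 0
S (suc n) zero    = 0
S (suc n) (suc k) = suc k * S n (suc k) + S n k

rhs : ℕ → ℕ
rhs n = sum (map (λ k → 2 ^ k * S n k) (map suc (upTo n)))

module Submission where

-- A coloured partition eq-avoids {1^a1^b, 1^a1^a} iff every
-- element coloured a is the largest element of its block.  Build a partition
-- of {0,…,n-1} by inserting the elements from n-1 down to 0: the newly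
-- inserted least element either forms a new block, and may then take either
-- colour, or joins one of the k blocks present, and must then be coloured b
-- (its block now contains a larger element).  These insertion histories
-- (`Code n k`) number 2^k S(n,k), and decoding them is a bijection onto the
-- avoiding coloured partitions; summing over k gives the first equality.
-- Reversing the order of [n] turns every occurrence of 1^γ1^δ into one of
-- 1^δ1^γ, so it maps Π^eq≀C₂(R) bijectively onto Π^eq≀C₂(R with every pattern
-- swapped); this gives the second equality.

open import Defs
open import Data.Bool using (Bool; true; false; _∧_; not; T)
open import Data.Bool.Properties using (T-∧; T-irrelevant; T?)
open import Data.Bool.ListAction using (all; any)
open import Data.Empty using (⊥; ⊥-elim)
open import Data.Fin using (Fin; zero; suc; fromℕ; inject₁; opposite; _≟_; _<_)
open import Data.Fin.Properties
  using (fromℕ≢inject₁; inject₁-injective; opposite-involutive; toℕ-inject₁; toℕ-fromℕ;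
         toℕ<n; any?; 0↔⊥; +↔⊎; *↔×)
open import Data.List using (List; _∷_; []; allFin; map; applyUpTo)
open import Data.List.Membership.Propositional using (_∈_; lose)
open import Data.List.Membership.Propositional.Properties using (∈-allFin; ∈-map⁺; ∈-map⁻)
open import Data.List.Properties using (map-applyUpTo)
import Data.List.Relation.Unary.All as All
open import Data.List.Relation.Unary.All.Properties using (all⁺; all⁻)
open import Data.List.Relation.Unary.Any using (here; there; satisfied)
open import Data.List.Relation.Unary.Any.Properties using (any⁺; any⁻)
open import Data.Nat using (ℕ; zero; suc; _+_; _*_; _^_; _≤_; z≤n; s≤s; s<s)
open import Data.Nat.ListAction using (sum)
open import Data.Nat.Properties using (<ᵇ⇒<; <⇒<ᵇ; *-zeroʳ; m≤n⇒m≤1+n; <⇒≱)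
open import Data.Nat.Solver using (module +-*-Solver)
open import Data.Product using (Σ; ∃; _×_; _,_; proj₁; proj₂; swap; uncurry)
open import Data.Product.Function.NonDependent.Propositional using (_×-↔_)
open import Data.Sum using (_⊎_; inj₁; inj₂)
open import Data.Sum.Function.Propositional using (_⊎-↔_)
open import Data.Vec using (Vec; lookup; tabulate)
open import Data.Vec.Properties using (lookup∘tabulate; tabulate∘lookup; tabulate-cong)
open import Function using (_∘_; _⇔_; mk⇔; Equivalence)
open import Function.Bundles using (_↔_; mk↔ₛ′)
open import Function.Properties.Inverse using (↔-refl; ↔-sym; ↔-trans)
open import Relation.Binary.PropositionalEquality
  using (_≡_; refl; sym; trans; cong; cong₂; subst; module ≡-Reasoning)
open import Relation.Binary.Structures using (IsEquivalence)
import Relation.Binary.Construct.On as On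
open import Relation.Nullary using (¬_; yes; no)
open import Relation.Nullary.Decidable using (⌊_⌋; does-⇔; toWitness; fromWitness)

variable
  n k k′ : ℕ

-- (1) Reflection

BRel : ℕ → Set
BRel n = Fin n → Fin n → Bool

IsPartition : BRel n → Set
IsPartition {n} R = IsEquivalence {A = Fin n} (λ i j → T (R i j))

T-injective : ∀ {x y} → (T x ⇔ T y) → x ≡ y
T-injective {x} {y} e = does-⇔ e (T? x) (T? y)

row-eq : {R : BRel n} → IsPartition R → ∀ {u v} → T (R u v) → ∀ x → R u x ≡ R v x
row-eq eqv uv x = T-injective (mk⇔ (IsEquivalence.trans eqv (IsEquivalence.sym eqv uv))
                                   (IsEquivalence.trans eqv uv))

col-eq : {R : BRel n} → IsPartition R → ∀ {u v} → T (R u v) → ∀ x → R x u ≡ R x v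
col-eq eqv uv x = T-injective (mk⇔ (λ xu → IsEquivalence.trans eqv xu uv)
                                   (λ xv → IsEquivalence.trans eqv xv (IsEquivalence.sym eqv uv)))

symmetric-eq : {R : BRel n} → IsPartition R → ∀ x y → R x y ≡ R y x
symmetric-eq eqv x y = T-injective (mk⇔ (IsEquivalence.sym eqv) (IsEquivalence.sym eqv))

all-allFin⁺ : (p : Fin n → Bool) → T (all p (allFin n)) → ∀ i → T (p i)
all-allFin⁺ p t i = All.lookup (all⁺ p _ t) (∈-allFin i)

all-allFin⁻ : ∀ {n} (p : Fin n → Bool) → (∀ i → T (p i)) → T (all p (allFin n))
all-allFin⁻ {n} p h = all⁻ p {xs = allFin n} (All.tabulate (λ {i} _ → h i))

any-allFin⁺ : ∀ {n} (p : Fin n → Bool) → T (any p (allFin n)) → ∃ λ i → T (p i)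
any-allFin⁺ {n} p t = satisfied (any⁻ p (allFin n) t)

any-allFin⁻ : (p : Fin n → Bool) (i : Fin n) → T (p i) → T (any p (allFin n))
any-allFin⁻ p i t = any⁺ p (lose (∈-allFin i) t)

T-⇒ᵇ : ∀ {x y} → T (x ⇒ᵇ y) ⇔ (T x → T y)
T-⇒ᵇ {true}  = mk⇔ (λ t _ → t) (λ f → f _)
T-⇒ᵇ {false} = mk⇔ (λ _ ()) (λ _ → _)

T-not : ∀ {x} → T (not x) ⇔ (¬ T x)
T-not {true}  = mk⇔ (λ ()) (λ f → f _)
T-not {false} = mk⇔ (λ _ ()) (λ _ → _)

T-==ᶜ : ∀ {u v} → T (u ==ᶜ v) ⇔ (u ≡ v)
T-==ᶜ {a} {a} = mk⇔ (λ _ → refl) (λ _ → _)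
T-==ᶜ {a} {b} = mk⇔ (λ ()) (λ ())
T-==ᶜ {b} {a} = mk⇔ (λ ()) (λ ())
T-==ᶜ {b} {b} = mk⇔ (λ _ → refl) (λ _ → _)

-- The three conjuncts of isEquivᵇ; isEquivᵇ M is definitionally their conjunction.
reflexiveᵇ symmetricᵇ transitiveᵇ : Matrix n → Bool
reflexiveᵇ  {n} M = all (λ i → rel M i i) (allFin n)
symmetricᵇ  {n} M = all (λ i → all (λ j → rel M i j ⇒ᵇ rel M j i) (allFin n)) (allFin n)
transitiveᵇ {n} M = all (λ i → all (λ j → all (λ k → (rel M i j ∧ rel M j k) ⇒ᵇ rel M i k)
                                              (allFin n)) (allFin n)) (allFin n)

isEquivᵇ-sound : (M : Matrix n) → T (isEquivᵇ M) → IsPartition (rel M)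
isEquivᵇ-sound M t = record
  { refl  = λ {i} → all-allFin⁺ _ reflᵇ i
  ; sym   = λ {i} {j} → Equivalence.to T-⇒ᵇ (all-allFin⁺ _ (all-allFin⁺ _ symᵇ i) j)
  ; trans = λ {i} {j} {k} ij jk →
      Equivalence.to T-⇒ᵇ (all-allFin⁺ _ (all-allFin⁺ _ (all-allFin⁺ _ transᵇ i) j) k)
                          (Equivalence.from T-∧ (ij , jk))
  }
  where
  reflᵇ : T (reflexiveᵇ M)
  reflᵇ = proj₁ (Equivalence.to (T-∧ {reflexiveᵇ M}) t)
  symᵇtransᵇ : T (symmetricᵇ M ∧ transitiveᵇ M)
  symᵇtransᵇ = proj₂ (Equivalence.to (T-∧ {reflexiveᵇ M}) t)
  symᵇ : T (symmetricᵇ M)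
  symᵇ = proj₁ (Equivalence.to (T-∧ {symmetricᵇ M}) symᵇtransᵇ)
  transᵇ : T (transitiveᵇ M)
  transᵇ = proj₂ (Equivalence.to (T-∧ {symmetricᵇ M}) symᵇtransᵇ)

isEquivᵇ-complete : (M : Matrix n) → IsPartition (rel M) → T (isEquivᵇ M)
isEquivᵇ-complete M eqv =
  Equivalence.from (T-∧ {reflexiveᵇ M})
    (reflᵇ , Equivalence.from (T-∧ {symmetricᵇ M}) (symᵇ , transᵇ))
  where
  reflᵇ : T (reflexiveᵇ M)
  reflᵇ = all-allFin⁻ _ (λ i → IsEquivalence.refl eqv {i})
  symᵇ : T (symmetricᵇ M)
  symᵇ = all-allFin⁻ _ λ i → all-allFin⁻ _ λ j →
           Equivalence.from T-⇒ᵇ (IsEquivalence.sym eqv {i} {j})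
  transᵇ : T (transitiveᵇ M)
  transᵇ = all-allFin⁻ _ λ i → all-allFin⁻ _ λ j → all-allFin⁻ _ λ k →
             Equivalence.from T-⇒ᵇ (uncurry (IsEquivalence.trans eqv {i} {j} {k}) ∘ Equivalence.to T-∧)

data Occurs (R : BRel n) (C : Fin n → Color) (γ δ : Color) : Set where
  occ : (x y : Fin n) → x < y → T (R x y) → C x ≡ γ → C y ≡ δ → Occurs R C γ δ

Avoids : List Pattern → BRel n → (Fin n → Color) → Set
Avoids Ps R C = ∀ {γ δ} → (γ , δ) ∈ Ps → ¬ Occurs R C γ δ

eqContainsᵇ-sound : (M : Matrix n) (c : Vec Color n) {γ δ : Color} →
  T (eqContainsᵇ M c γ δ) → Occurs (rel M) (lookup c) γ δ
eqContainsᵇ-sound M c t with any-allFin⁺ _ t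
... | x , tx with any-allFin⁺ _ tx
... | y , txy with Equivalence.to T-∧ txy
... | x<y , rest with Equivalence.to T-∧ rest
... | xy , colours with Equivalence.to T-∧ colours
... | cx , cy = occ x y (<ᵇ⇒< _ _ x<y) xy (Equivalence.to T-==ᶜ cx) (Equivalence.to T-==ᶜ cy)

eqContainsᵇ-complete : (M : Matrix n) (c : Vec Color n) {γ δ : Color} →
  Occurs (rel M) (lookup c) γ δ → T (eqContainsᵇ M c γ δ)
eqContainsᵇ-complete M c (occ x y x<y xy cx cy) =
  any-allFin⁻ _ x (any-allFin⁻ _ y (Equivalence.from T-∧ (<⇒<ᵇ x<y ,
    Equivalence.from T-∧ (xy , Equivalence.from T-∧
      (Equivalence.from T-==ᶜ cx , Equivalence.from T-==ᶜ cy)))))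

avoidsᵇ-sound : (Ps : List Pattern) (M : Matrix n) (c : Vec Color n) →
  T (avoidsᵇ Ps M c) → Avoids Ps (rel M) (lookup c)
avoidsᵇ-sound Ps M c t γδ∈Ps o =
  Equivalence.to T-not (All.lookup (all⁺ _ Ps t) γδ∈Ps) (eqContainsᵇ-complete M c o)

avoidsᵇ-complete : (Ps : List Pattern) (M : Matrix n) (c : Vec Color n) →
  Avoids Ps (rel M) (lookup c) → T (avoidsᵇ Ps M c)
avoidsᵇ-complete Ps M c av =
  all⁻ _ (All.tabulate (λ γδ∈Ps → Equivalence.from T-not (av γδ∈Ps ∘ eqContainsᵇ-sound M c)))

MaxAvoiders : List Pattern
MaxAvoiders = (a , b) ∷ (a , a) ∷ []

AMax : BRel n → (Fin n → Color) → Set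
AMax R C = ∀ x y → x < y → T (R x y) → C x ≡ a → ⊥

AMax⇒Avoids : {R : BRel n} {C : Fin n → Color} → AMax R C → Avoids MaxAvoiders R C
AMax⇒Avoids amax (here refl)         (occ x y x<y xy cx _) = amax x y x<y xy cx
AMax⇒Avoids amax (there (here refl)) (occ x y x<y xy cx _) = amax x y x<y xy cx

Avoids⇒AMax : {R : BRel n} {C : Fin n → Color} → Avoids MaxAvoiders R C → AMax R C
Avoids⇒AMax {C = C} av x y x<y xy cx with C y in cy
... | a = av (there (here refl)) (occ x y x<y xy cx cy)
... | b = av (here refl) (occ x y x<y xy cx cy)

toMatrix : BRel n → Matrix n
toMatrix R = tabulate (λ i → tabulate (R i))

rel-toMatrix : (R : BRel n) (i j : Fin n) → rel (toMatrix R) i j ≡ R i j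
rel-toMatrix R i j = trans (cong (λ row → lookup row j) (lookup∘tabulate _ i)) (lookup∘tabulate _ j)

vec-ext : {A : Set} (u v : Vec A n) → (∀ i → lookup u i ≡ lookup v i) → u ≡ v
vec-ext u v h = trans (sym (tabulate∘lookup u)) (trans (tabulate-cong h) (tabulate∘lookup v))

colPart-ext : (Ps : List Pattern) {M M′ : Matrix n} {c c′ : Vec Color n}
  (t : T (isEquivᵇ M ∧ avoidsᵇ Ps M c)) (t′ : T (isEquivᵇ M′ ∧ avoidsᵇ Ps M′ c′)) →
  (∀ i j → rel M i j ≡ rel M′ i j) → (∀ i → lookup c i ≡ lookup c′ i) →
  _≡_ {A = ColPartAvoid n Ps} ((M , c) , t) ((M′ , c′) , t′)
colPart-ext Ps {M} {M′} {c} {c′} t t′ hM hc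
  with vec-ext M M′ (λ i → vec-ext _ _ (hM i)) | vec-ext c c′ hc
... | refl | refl = cong (_ ,_) (T-irrelevant t t′)

IsPartition-cong : {R R′ : BRel n} → (∀ i j → R i j ≡ R′ i j) →
                   IsPartition R → IsPartition R′
IsPartition-cong h eqv = record
  { refl  = λ {i} → subst T (h i i) (IsEquivalence.refl eqv)
  ; sym   = λ {i} {j} ij → subst T (h j i) (IsEquivalence.sym eqv (subst T (sym (h i j)) ij))
  ; trans = λ {i} {j} {k} ij jk → subst T (h i k)
      (IsEquivalence.trans eqv (subst T (sym (h i j)) ij) (subst T (sym (h j k)) jk))
  }

Occurs-cong : {R R′ : BRel n} {C C′ : Fin n → Color} {γ δ : Color} →
  (∀ i j → R i j ≡ R′ i j) → (∀ i → C i ≡ C′ i) → Occurs R′ C′ γ δ → Occurs R C γ δ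
Occurs-cong hR hC (occ x y x<y xy cx cy) =
  occ x y x<y (subst T (sym (hR x y)) xy) (trans (hC x) cx) (trans (hC y) cy)

tabulated : (Ps : List Pattern) (R : BRel n) (C : Fin n → Color) →
  IsPartition R → Avoids Ps R C → ColPartAvoid n Ps
tabulated Ps R C eqv av = (toMatrix R , tabulate C) , Equivalence.from T-∧
  ( isEquivᵇ-complete (toMatrix R) (IsPartition-cong (λ i j → sym (rel-toMatrix R i j)) eqv)
  , avoidsᵇ-complete Ps (toMatrix R) (tabulate C)
      (λ γδ∈Ps → av γδ∈Ps ∘ Occurs-cong (λ i j → sym (rel-toMatrix R i j))
                                         (λ i → sym (lookup∘tabulate C i))))

partition-of : (Ps : List Pattern) (x : ColPartAvoid n Ps) → IsPartition (rel (proj₁ (proj₁ x)))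
partition-of Ps ((M , c) , t) = isEquivᵇ-sound M (proj₁ (Equivalence.to T-∧ t))

avoids-of : (Ps : List Pattern) (x : ColPartAvoid n Ps) →
  Avoids Ps (rel (proj₁ (proj₁ x))) (lookup (proj₂ (proj₁ x)))
avoids-of Ps ((M , c) , t) = avoidsᵇ-sound Ps M c (proj₂ (Equivalence.to T-∧ t))

-- (2) Codes

-- Code n k: insertion history of a coloured partition of {0,…,n-1} into k
-- labelled blocks whose a-coloured elements are block maxima.  The element
-- 0 either joins the block with the given label (and is coloured b), or
-- forms a new singleton block, labelled k, of the given colour.
data Code : ℕ → ℕ → Set where
  empty : Code 0 0
  join  : Fin k → Code n k → Code (suc n) k
  fresh : Color → Code n k → Code (suc n) (suc k)

block : Code n k → Fin n → Fin k
block (join ℓ p)  zero    = ℓ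
block (join ℓ p)  (suc i) = block p i
block (fresh c p) zero    = fromℕ _
block (fresh c p) (suc i) = inject₁ (block p i)

colour : Code n k → Fin n → Color
colour (join ℓ p)  zero    = b
colour (join ℓ p)  (suc i) = colour p i
colour (fresh c p) zero    = c
colour (fresh c p) (suc i) = colour p i

sameBlock : Code n k → BRel n
sameBlock p i j = ⌊ block p i ≟ block p j ⌋

fromℕ-or-inject₁ : (ℓ : Fin (suc k)) → (fromℕ k ≡ ℓ) ⊎ ∃ λ ℓ′ → inject₁ ℓ′ ≡ ℓ
fromℕ-or-inject₁ {zero}  zero    = inj₁ refl
fromℕ-or-inject₁ {suc k} zero    = inj₂ (zero , refl)
fromℕ-or-inject₁ {suc k} (suc ℓ) with fromℕ-or-inject₁ ℓ
... | inj₁ e        = inj₁ (cong suc e)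
... | inj₂ (ℓ′ , e) = inj₂ (suc ℓ′ , cong suc e)

block-surjective : (p : Code n k) (ℓ : Fin k) → ∃ λ i → block p i ≡ ℓ
block-surjective (join ℓ′ p) ℓ = let i , e = block-surjective p ℓ in suc i , e
block-surjective (fresh c p) ℓ with fromℕ-or-inject₁ ℓ
... | inj₁ e        = zero , e
... | inj₂ (ℓ′ , e) = let i , e′ = block-surjective p ℓ′ in suc i , trans (cong inject₁ e′) e

Code-bound : Code n k → k ≤ n
Code-bound empty       = z≤n
Code-bound (join ℓ p)  = m≤n⇒m≤1+n (Code-bound p)
Code-bound (fresh c p) = s≤s (Code-bound p)

Code-step : Code (suc n) (suc k) ↔ ((Fin (suc k) × Code n (suc k)) ⊎ (Color × Code n k))
Code-step = mk↔ₛ′ split unsplit (λ { (inj₁ _) → refl ; (inj₂ _) → refl })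
                               (λ { (join _ _) → refl ; (fresh _ _) → refl })
  where
  split : Code (suc _) (suc _) → _
  split (join ℓ p)  = inj₁ (ℓ , p)
  split (fresh c p) = inj₂ (c , p)
  unsplit : _ → Code (suc _) (suc _)
  unsplit (inj₁ (ℓ , p)) = join ℓ p
  unsplit (inj₂ (c , p)) = fresh c p

Color↔Fin2 : Color ↔ Fin 2
Color↔Fin2 = mk↔ₛ′ (λ { a → zero ; b → suc zero }) (λ { zero → a ; (suc zero) → b })
                   (λ { zero → refl ; (suc zero) → refl }) (λ { a → refl ; b → refl })

Fin-cong : ∀ {m m′} → m ≡ m′ → Fin m ↔ Fin m′
Fin-cong refl = ↔-refl

empty↔Fin0 : {A : Set} → ¬ A → A ↔ Fin 0
empty↔Fin0 ¬A = ↔-trans (mk↔ₛ′ ¬A (λ ()) (λ ()) (⊥-elim ∘ ¬A)) (↔-sym 0↔⊥)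

weighted-Stirling : ∀ n k → suc k * (2 ^ suc k * S n (suc k)) + 2 * (2 ^ k * S n k)
                            ≡ 2 ^ suc k * S (suc n) (suc k)
weighted-Stirling n k = solve 4 (λ k p x y → (con 1 :+ k) :* ((con 2 :* p) :* x) :+ con 2 :* (p :* y)
                                           := (con 2 :* p) :* ((con 1 :+ k) :* x :+ y))
                              refl k (2 ^ k) (S n (suc k)) (S n k)
  where open +-*-Solver

Code↔Fin : ∀ n k → Code n k ↔ Fin (2 ^ k * S n k)
Code↔Fin zero    zero    =
  mk↔ₛ′ (λ _ → zero) (λ _ → empty) (λ { zero → refl }) (λ { empty → refl })
Code↔Fin zero    (suc k) = ↔-trans (empty↔Fin0 (λ ())) (Fin-cong (sym (*-zeroʳ (2 ^ suc k))))
Code↔Fin (suc n) zero    = empty↔Fin0 (λ { (join () _) })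
Code↔Fin (suc n) (suc k) =
  ↔-trans Code-step
  (↔-trans ((↔-refl ×-↔ Code↔Fin n (suc k)) ⊎-↔ (Color↔Fin2 ×-↔ Code↔Fin n k))
  (↔-trans (↔-sym *↔× ⊎-↔ ↔-sym *↔×)
  (↔-trans (↔-sym +↔⊎) (Fin-cong (weighted-Stirling n k)))))

Σ↔sum : ∀ m {F : ℕ → Set} {f : ℕ → ℕ} → (∀ k → F k ↔ Fin (f k)) →
        (∀ k → m ≤ k → ¬ F k) → Σ ℕ F ↔ Fin (sum (applyUpTo f m))
Σ↔sum zero    iso vanish = empty↔Fin0 (λ (k , x) → vanish k z≤n x)
Σ↔sum (suc m) {F} iso vanish =
  ↔-trans Σ-split
    (↔-trans (iso 0 ⊎-↔ Σ↔sum m (iso ∘ suc) (λ k m≤k → vanish (suc k) (s≤s m≤k)))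
             (↔-sym +↔⊎))
  where
  Σ-split : Σ ℕ F ↔ (F 0 ⊎ Σ ℕ (F ∘ suc))
  Σ-split = mk↔ₛ′ (λ { (zero , x) → inj₁ x ; (suc k , x) → inj₂ (k , x) })
                  (λ { (inj₁ x) → 0 , x ; (inj₂ (k , x)) → suc k , x })
                  (λ { (inj₁ _) → refl ; (inj₂ _) → refl })
                  (λ { (zero , _) → refl ; (suc _ , _) → refl })

codes↔rhs : ∀ n → Σ ℕ (Code (suc n)) ↔ Fin (rhs (suc n))
codes↔rhs n = ↔-trans (Σ↔sum (suc (suc n)) (Code↔Fin (suc n))
                              (λ k n<k p → <⇒≱ n<k (Code-bound p)))
                      (Fin-cong (sym (cong sum rhs-as-applyUpTo)))
  where
  weight : ℕ → ℕ
  weight k = 2 ^ k * S (suc n) k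
  rhs-as-applyUpTo : map weight (map suc (applyUpTo (λ i → i) (suc n)))
                   ≡ applyUpTo (weight ∘ suc) (suc n)
  rhs-as-applyUpTo = trans (cong (map weight) (map-applyUpTo (λ i → i) suc (suc n)))
                           (map-applyUpTo suc weight (suc n))

-- (3) Decoding is a bijection onto the avoiders of {1^a1^b, 1^a1^a}

label-sym : (x y : Fin k) → ⌊ x ≟ y ⌋ ≡ ⌊ y ≟ x ⌋
label-sym x y = T-injective (mk⇔ (fromWitness ∘ sym ∘ toWitness) (fromWitness ∘ sym ∘ toWitness))

same-label : (x : Fin k) → ⌊ x ≟ x ⌋ ≡ true
same-label x = T-injective (mk⇔ (λ _ → _) (λ _ → fromWitness refl))

label-inject₁ : (x y : Fin k) → ⌊ inject₁ x ≟ inject₁ y ⌋ ≡ ⌊ x ≟ y ⌋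
label-inject₁ x y = T-injective (mk⇔ (fromWitness ∘ inject₁-injective ∘ toWitness)
                                         (fromWitness ∘ cong inject₁ ∘ toWitness))

label-fresh : (y : Fin k) → ⌊ fromℕ k ≟ inject₁ y ⌋ ≡ false
label-fresh y = T-injective (mk⇔ (fromℕ≢inject₁ ∘ toWitness) (λ ()))

label-transport : {x y : Fin k} {x′ y′ : Fin k′} → ⌊ x ≟ y ⌋ ≡ ⌊ x′ ≟ y′ ⌋ → x ≡ y → x′ ≡ y′
label-transport e x≡y = toWitness (subst T e (fromWitness x≡y))

decode-partition : (p : Code n k) → IsPartition (sameBlock p)
decode-partition p = On.isEquivalence (block p) {≈ = λ x y → T ⌊ x ≟ y ⌋} (record
  { refl  = fromWitness refl
  ; sym   = λ e → fromWitness (sym (toWitness e))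
  ; trans = λ e e′ → fromWitness (trans (toWitness e) (toWitness e′)) })

decode-AMax : (p : Code n k) → AMax (sameBlock p) (colour p)
decode-AMax (join ℓ p)  zero    y       x<y xy ()
decode-AMax (join ℓ p)  (suc x) (suc y) (s<s x<y) xy cx = decode-AMax p x y x<y xy cx
decode-AMax (fresh c p) zero    (suc y) x<y xy cx =
  subst T (label-fresh (block p y)) xy
decode-AMax (fresh c p) (suc x) (suc y) (s<s x<y) xy cx =
  decode-AMax p x y x<y (subst T (label-inject₁ (block p x) (block p y)) xy) cx

Encodes : Code n k → BRel n → (Fin n → Color) → Set
Encodes p R C = (∀ i j → sameBlock p i j ≡ R i j) × (∀ i → colour p i ≡ C i)

encodes-join : {R : BRel (suc n)} {C : Fin (suc n) → Color} →
  IsPartition R → AMax R C → (p : Code n k) →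
  Encodes p (λ i j → R (suc i) (suc j)) (C ∘ suc) →
  ∀ j → T (R zero (suc j)) → Encodes (join (block p j) p) R C
encodes-join {R = R} {C} eqv amax p (same , cols) j 0~j = same′ , cols′
  where
  same′ : ∀ i i′ → sameBlock (join (block p j) p) i i′ ≡ R i i′
  same′ zero    zero     = trans (same-label (block p j))
                                 (sym (T-injective (mk⇔ (λ _ → _) (λ _ → IsEquivalence.refl eqv))))
  same′ zero    (suc i′) = trans (same j i′) (sym (row-eq eqv 0~j (suc i′)))
  same′ (suc i) zero     = trans (same i j) (sym (col-eq eqv 0~j (suc i)))
  same′ (suc i) (suc i′) = same i i′
  cols′ : ∀ i → colour (join (block p j) p) i ≡ C i
  cols′ zero with C zero in c0
  ... | a = ⊥-elim (amax zero (suc j) (s<s z≤n) 0~j c0)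
  ... | b = refl
  cols′ (suc i) = cols i

encodes-fresh : {R : BRel (suc n)} {C : Fin (suc n) → Color} →
  IsPartition R → (p : Code n k) →
  Encodes p (λ i j → R (suc i) (suc j)) (C ∘ suc) →
  (∀ j → ¬ T (R zero (suc j))) → Encodes (fresh (C zero) p) R C
encodes-fresh {R = R} {C} eqv p (same , cols) alone = same′ , cols′
  where
  unrelated : ∀ j → R zero (suc j) ≡ false
  unrelated j = T-injective (mk⇔ (alone j) (λ ()))
  same′ : ∀ i i′ → sameBlock (fresh _ p) i i′ ≡ R i i′
  same′ zero    zero     = trans (same-label (fromℕ _))
                                 (sym (T-injective (mk⇔ (λ _ → _) (λ _ → IsEquivalence.refl eqv))))
  same′ zero    (suc i′) = trans (label-fresh (block p i′)) (sym (unrelated i′))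
  same′ (suc i) zero     = trans (label-sym (inject₁ (block p i)) (fromℕ _))
                                 (trans (same′ zero (suc i)) (symmetric-eq eqv zero (suc i)))
  same′ (suc i) (suc i′) = trans (label-inject₁ (block p i) (block p i′)) (same i i′)
  cols′ : ∀ i → colour (fresh _ p) i ≡ C i
  cols′ zero    = refl
  cols′ (suc i) = cols i

encode : ∀ n (R : BRel n) (C : Fin n → Color) → IsPartition R → AMax R C →
         ∃ λ k → Σ (Code n k) λ p → Encodes p R C
encode zero    R C eqv amax = 0 , empty , (λ ()) , (λ ())
encode (suc n) R C eqv amax
  with encode n (λ i j → R (suc i) (suc j)) (C ∘ suc) (On.isEquivalence suc eqv)
                (λ x y x<y → amax (suc x) (suc y) (s<s x<y))
... | k , p , enc with any? (λ j → T? (R zero (suc j)))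
...   | yes (j , 0~j) = k , join (block p j) p , encodes-join eqv amax p enc j 0~j
...   | no  alone     = suc k , fresh _ p , encodes-fresh eqv p enc (λ j 0~j → alone (j , 0~j))

decode-injective : (p : Code n k) (q : Code n k′) →
  (∀ i j → sameBlock p i j ≡ sameBlock q i j) → (∀ i → colour p i ≡ colour q i) →
  _≡_ {A = Σ ℕ (Code n)} (k , p) (k′ , q)
decode-injective empty empty _ _ = refl
decode-injective (join ℓ p) (join ℓ′ q) same cols
  with decode-injective p q (λ i j → same (suc i) (suc j)) (cols ∘ suc)
... | refl with block-surjective p ℓ
...   | i , e = cong (λ ℓ → _ , join ℓ p)
                     (trans (sym e) (sym (label-transport (same zero (suc i)) (sym e))))
decode-injective (join ℓ p) (fresh c q) same cols with block-surjective p ℓ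
... | i , e = ⊥-elim (fromℕ≢inject₁ (label-transport (same zero (suc i)) (sym e)))
decode-injective (fresh c p) (join ℓ q) same cols with block-surjective q ℓ
... | i , e = ⊥-elim (fromℕ≢inject₁ (label-transport (sym (same zero (suc i))) (sym e)))
decode-injective (fresh c p) (fresh c′ q) same cols
  with decode-injective p q (λ i j → trans (sym (label-inject₁ (block p i) (block p j)))
                                    (trans (same (suc i) (suc j)) (label-inject₁ (block q i) (block q j))))
                            (cols ∘ suc)
... | refl = cong (λ c → _ , fresh c p) (cols zero)

avoiders↔codes : ColPartAvoid n MaxAvoiders ↔ Σ ℕ (Code n)
avoiders↔codes {n} = mk↔ₛ′ to from to∘from from∘to
  where
  encodeᴾ : (x : ColPartAvoid n MaxAvoiders) →
    ∃ λ k → Σ (Code n k) λ p → Encodes p (rel (proj₁ (proj₁ x))) (lookup (proj₂ (proj₁ x)))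
  encodeᴾ x = encode n _ _ (partition-of MaxAvoiders x) (Avoids⇒AMax (avoids-of MaxAvoiders x))
  to : ColPartAvoid n MaxAvoiders → Σ ℕ (Code n)
  to x = proj₁ (encodeᴾ x) , proj₁ (proj₂ (encodeᴾ x))
  from : Σ ℕ (Code n) → ColPartAvoid n MaxAvoiders
  from (k , p) = tabulated MaxAvoiders (sameBlock p) (colour p)
                           (decode-partition p) (AMax⇒Avoids (decode-AMax p))
  to∘from : ∀ y → to (from y) ≡ y
  to∘from (k , p) = let _ , _ , same , cols = encodeᴾ (from (k , p)) in
    decode-injective _ p (λ i j → trans (same i j) (rel-toMatrix (sameBlock p) i j))
                         (λ i → trans (cols i) (lookup∘tabulate (colour p) i))
  from∘to : ∀ x → from (to x) ≡ x
  from∘to x@(_ , t) = let _ , p , same , cols = encodeᴾ x in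
    colPart-ext MaxAvoiders _ t (λ i j → trans (rel-toMatrix (sameBlock p) i j) (same i j))
                    (λ i → trans (lookup∘tabulate (colour p) i) (cols i))

-- (4) Reversal

opposite-< : (x y : Fin n) → x < y → opposite y < opposite x
opposite-< {suc n} zero    (suc y) _
  rewrite toℕ-inject₁ (opposite y) | toℕ-fromℕ n = toℕ<n (opposite y)
opposite-< {suc n} (suc x) (suc y) (s<s x<y)
  rewrite toℕ-inject₁ (opposite y) | toℕ-inject₁ (opposite x) = opposite-< x y x<y

Occurs-reverse : {R : BRel n} {C : Fin n → Color} {γ δ : Color} → IsPartition R →
  Occurs (λ i j → R (opposite i) (opposite j)) (C ∘ opposite) γ δ → Occurs R C δ γ
Occurs-reverse eqv (occ x y x<y xy cx cy) =
  occ (opposite y) (opposite x) (opposite-< x y x<y) (IsEquivalence.sym eqv xy) cy cx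

reverse : {Ps Qs : List Pattern} → (∀ {γ δ} → (γ , δ) ∈ Ps → (δ , γ) ∈ Qs) →
          ColPartAvoid n Qs → ColPartAvoid n Ps
reverse {Ps = Ps} {Qs} swapped x@((M , c) , _) =
  tabulated Ps (λ i j → rel M (opposite i) (opposite j)) (lookup c ∘ opposite)
    (On.isEquivalence opposite (partition-of Qs x))
    (λ γδ∈Ps o → avoids-of Qs x (swapped γδ∈Ps) (Occurs-reverse (partition-of Qs x) o))

reverse-involutive : {Ps Qs : List Pattern} (h : ∀ {γ δ} → (γ , δ) ∈ Ps → (δ , γ) ∈ Qs)
  (h′ : ∀ {γ δ} → (γ , δ) ∈ Qs → (δ , γ) ∈ Ps) (x : ColPartAvoid n Qs) →
  reverse h′ (reverse h x) ≡ x
reverse-involutive {Qs = Qs} h h′ x@((M , c) , t) = colPart-ext Qs _ t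
  (λ i j → begin
    rel (toMatrix _) i j                                   ≡⟨ rel-toMatrix _ i j ⟩
    rel (toMatrix _) (opposite i) (opposite j)             ≡⟨ rel-toMatrix _ (opposite i) (opposite j) ⟩
    rel M (opposite (opposite i)) (opposite (opposite j))  ≡⟨ cong₂ (rel M) (opposite-involutive i)
                                                                            (opposite-involutive j) ⟩
    rel M i j                                              ∎)
  (λ i → begin
    lookup (tabulate _) i                     ≡⟨ lookup∘tabulate _ i ⟩
    lookup (tabulate _) (opposite i)          ≡⟨ lookup∘tabulate _ (opposite i) ⟩
    lookup c (opposite (opposite i))          ≡⟨ cong (lookup c) (opposite-involutive i) ⟩
    lookup c i                                ∎)
  where open ≡-Reasoning

reversal↔ : (Ps : List Pattern) → ColPartAvoid n Ps ↔ ColPartAvoid n (map swap Ps)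
reversal↔ Ps = mk↔ₛ′ (reverse unswap) (reverse swap∈)
                     (reverse-involutive swap∈ unswap) (reverse-involutive unswap swap∈)
  where
  swap∈ : ∀ {γ δ} → (γ , δ) ∈ Ps → (δ , γ) ∈ map swap Ps
  swap∈ = ∈-map⁺ swap
  unswap : ∀ {γ δ} → (γ , δ) ∈ map swap Ps → (δ , γ) ∈ Ps
  unswap γδ∈ with ∈-map⁻ swap γδ∈
  ... | _ , mem , refl = mem

theorem3p4 : (n : ℕ) → 1 ≤ n →
    (ColPartAvoid n ((a , b) ∷ (a , a) ∷ []) ↔ Fin (rhs n)) ×
    (ColPartAvoid n ((b , a) ∷ (a , a) ∷ []) ↔ Fin (rhs n))
theorem3p4 (suc n) _ = avoiders↔rhs , ↔-trans (↔-sym (reversal↔ MaxAvoiders)) avoiders↔rhs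
  where
  avoiders↔rhs : ColPartAvoid (suc n) MaxAvoiders ↔ Fin (rhs (suc n))
  avoiders↔rhs = ↔-trans avoiders↔codes (codes↔rhs n)
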